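{- For every integer $n\ge 0$ there is a bijection between $\mathcal{D}^{\mathfrak{S}}(n)$ and $\mathcal{T}(n)$.
   Context: A Dyck path of length $2n$ is a word in the letters $U,D$ with $n$ letters of each kind such that every prefix contains at least as many $U$'s as $D$'s. A $k$-ascent of a Dyck path is a maximal block of $k$ consecutive letters $U$. A Schröder path of length $2k$ is a lattice path from $(0,0)$ to $(2k,0)$ with steps $(1,1)$, $(1,-1)$, $(2,0)$ that never goes below the $x$-axis; $\mathcal{S}(k)$ is the set of these. $\mathcal{D}^{\mathfrak{S}}(n)$ is the set of Dyck paths $P$ of length $2n$ together with an assignment, to each ascent of $P$ of length $k$, of an element of $\mathcal{S}(k)$. $\mathcal{T}(n)$ is the set of lattice paths from $(0,0)$ to $(3n,0)$ with steps $H=(1,2)$, $G=(2,1)$, $D=(1,-1)$ that never go below the $x$-axis. -}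

module Defs where

open import Data.Nat using (ℕ; zero; suc; _+_; _*_)
open import Data.List using (List; []; _∷_; length)
open import Data.List.Relation.Unary.All using (All)
open import Data.Product using (Σ; _×_)
open import Relation.Binary.PropositionalEquality using (_≡_)

data DStep : Set where
  U D : DStep

data IsDyckFrom : ℕ → List DStep → Set where
  dend  : IsDyckFrom 0 []
  dup   : ∀ {h w} → IsDyckFrom (suc h) w → IsDyckFrom h (U ∷ w)
  ddown : ∀ {h w} → IsDyckFrom h w → IsDyckFrom (suc h) (D ∷ w)

DyckPath : ℕ → Set
DyckPath n = Σ (List DStep) λ w → IsDyckFrom 0 w × length w ≡ 2 * n

-- Lengths of the ascents (maximal blocks of consecutive U's), in order
-- of appearance.  The first argument is the length of the current run.
ascentsFrom : ℕ → List DStep → List ℕ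
ascentsFrom zero    []      = []
ascentsFrom (suc k) []      = suc k ∷ []
ascentsFrom k       (U ∷ w) = ascentsFrom (suc k) w
ascentsFrom zero    (D ∷ w) = ascentsFrom zero w
ascentsFrom (suc k) (D ∷ w) = suc k ∷ ascentsFrom zero w

ascents : List DStep → List ℕ
ascents = ascentsFrom zero

-- Schröder paths: steps (1,1), (1,-1), (2,0), never below the x-axis.

data SStep : Set where
  sU sD sF : SStep

data IsSchroderFrom : ℕ → List SStep → Set where
  send  : IsSchroderFrom 0 []
  sup   : ∀ {h w} → IsSchroderFrom (suc h) w → IsSchroderFrom h (sU ∷ w)
  sdown : ∀ {h w} → IsSchroderFrom h w → IsSchroderFrom (suc h) (sD ∷ w)
  sflat : ∀ {h w} → IsSchroderFrom h w → IsSchroderFrom h (sF ∷ w)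

sWidth : List SStep → ℕ
sWidth []       = 0
sWidth (sU ∷ w) = 1 + sWidth w
sWidth (sD ∷ w) = 1 + sWidth w
sWidth (sF ∷ w) = 2 + sWidth w

SchroderPath : ℕ → Set
SchroderPath k = Σ (List SStep) λ w → IsSchroderFrom 0 w × sWidth w ≡ 2 * k

-- 𝒟^𝔖(n): a Dyck path of length 2n together with, for each ascent of
-- length k (in order), a Schröder path in 𝒮(k).

DS : ℕ → Set
DS n = Σ (DyckPath n) λ P → All SchroderPath (ascents (Σ.proj₁ P))

-- 𝒯(n): steps H = (1,2), G = (2,1), D = (1,-1), from (0,0) to (3n,0),
-- never below the x-axis.

data TStep : Set where
  tH tG tD : TStep

data IsTFrom : ℕ → List TStep → Set where
  tend  : IsTFrom 0 []
  tstepH : ∀ {h w} → IsTFrom (suc (suc h)) w → IsTFrom h (tH ∷ w)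
  tstepG : ∀ {h w} → IsTFrom (suc h) w → IsTFrom h (tG ∷ w)
  tstepD : ∀ {h w} → IsTFrom h w → IsTFrom (suc h) (tD ∷ w)

tWidth : List TStep → ℕ
tWidth []       = 0
tWidth (tH ∷ w) = 1 + tWidth w
tWidth (tG ∷ w) = 2 + tWidth w
tWidth (tD ∷ w) = 1 + tWidth w

TPath : ℕ → Set
TPath n = Σ (List TStep) λ w → IsTFrom 0 w × tWidth w ≡ 3 * n

-- Replace every ascent of the Dyck path by the Schröder path attached to it,
-- writing the Schröder steps (1,1), (2,0), (1,-1) as H, G, D, and keep the
-- down-steps of the Dyck path as D.  The result is a T-path whose height is
-- h + s, where h is the height of the Dyck path and s the height inside the
-- current Schröder path.  Conversely, a D of a T-path is a Schröder step
-- exactly when s > 0, so the marking of its D-steps, and with it the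
-- Dyck path and its decorations, can be recovered.  Each letter contributes
-- the same amount to both sides of 2 · width + h = 3 · (Dyck length) + 2 s,
-- which turns length 2n into width 3n.

module Submission where

open import Defs
open import Data.Nat using (ℕ; zero; suc; _+_; _*_)
open import Data.Nat.Properties using (+-suc; +-identityʳ; suc-injective; *-cancelˡ-≡; ≡-irrelevant)
open import Data.Nat.Tactic.RingSolver using (solve-∀)
open import Data.List using (List; []; _∷_; _++_; length; replicate; map)
open import Data.List.Relation.Unary.All using (All; []; _∷_)
open import Data.List.Relation.Binary.Pointwise using (Pointwise; []; _∷_)
import Data.List.Relation.Binary.Pointwise.Properties as Pointwise
open import Data.Product using (Σ; _×_; _,_; proj₁; proj₂)
open import Data.Product.Function.Dependent.Propositional using (Σ-↔)
open import Relation.Nullary using (Irrelevant)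
open import Relation.Binary.PropositionalEquality
  using (_≡_; refl; sym; trans; cong; cong₂; subst; module ≡-Reasoning)
open import Function.Bundles using (_⤖_; _↔_; mk↔ₛ′)
open import Function.Construct.Composition using (_↔-∘_)
open import Function.Construct.Identity using (↔-id)
open import Function.Properties.Inverse using (↔⇒⤖)

×-irrelevant : ∀ {A B : Set} → Irrelevant A → Irrelevant B → Irrelevant (A × B)
×-irrelevant irrA irrB (a , b) (a′ , b′) = cong₂ _,_ (irrA a a′) (irrB b b′)

Σ-≡-irrelevant : ∀ {A : Set} {B : A → Set} → (∀ {x} → Irrelevant (B x)) →
                 {p q : Σ A B} → proj₁ p ≡ proj₁ q → p ≡ q
Σ-≡-irrelevant irr {x , b} {.x , b′} refl = cong (x ,_) (irr b b′)

isDyckFrom-irrelevant : ∀ {h w} → Irrelevant (IsDyckFrom h w)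
isDyckFrom-irrelevant dend      dend      = refl
isDyckFrom-irrelevant (dup p)   (dup q)   = cong dup (isDyckFrom-irrelevant p q)
isDyckFrom-irrelevant (ddown p) (ddown q) = cong ddown (isDyckFrom-irrelevant p q)

isSchroderFrom-irrelevant : ∀ {h w} → Irrelevant (IsSchroderFrom h w)
isSchroderFrom-irrelevant send      send      = refl
isSchroderFrom-irrelevant (sup p)   (sup q)   = cong sup (isSchroderFrom-irrelevant p q)
isSchroderFrom-irrelevant (sdown p) (sdown q) = cong sdown (isSchroderFrom-irrelevant p q)
isSchroderFrom-irrelevant (sflat p) (sflat q) = cong sflat (isSchroderFrom-irrelevant p q)

isTFrom-irrelevant : ∀ {h w} → Irrelevant (IsTFrom h w)
isTFrom-irrelevant tend       tend       = refl
isTFrom-irrelevant (tstepH p) (tstepH q) = cong tstepH (isTFrom-irrelevant p q)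
isTFrom-irrelevant (tstepG p) (tstepG q) = cong tstepG (isTFrom-irrelevant p q)
isTFrom-irrelevant (tstepD p) (tstepD q) = cong tstepD (isTFrom-irrelevant p q)

module _ {A B : Set} {P : A → B → Set} where

  unzipAll : ∀ {xs} → All (λ x → Σ B (P x)) xs → Σ (List B) (Pointwise P xs)
  unzipAll []             = [] , []
  unzipAll ((y , p) ∷ ps) = y ∷ proj₁ (unzipAll ps) , p ∷ proj₂ (unzipAll ps)

  zipAll : ∀ {xs} → Σ (List B) (Pointwise P xs) → All (λ x → Σ B (P x)) xs
  zipAll ([]     , [])     = []
  zipAll (y ∷ ys , p ∷ ps) = (y , p) ∷ zipAll (ys , ps)

  unzipAll-zipAll : ∀ {xs} (yps : Σ (List B) (Pointwise P xs)) → unzipAll (zipAll yps) ≡ yps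
  unzipAll-zipAll ([]     , [])     = refl
  unzipAll-zipAll (y ∷ ys , p ∷ ps) rewrite unzipAll-zipAll (ys , ps) = refl

  zipAll-unzipAll : ∀ {xs} (ps : All (λ x → Σ B (P x)) xs) → zipAll (unzipAll ps) ≡ ps
  zipAll-unzipAll []       = refl
  zipAll-unzipAll (p ∷ ps) = cong (p ∷_) (zipAll-unzipAll ps)

  All↔Pointwise : ∀ {xs} → All (λ x → Σ B (P x)) xs ↔ Σ (List B) (Pointwise P xs)
  All↔Pointwise = mk↔ₛ′ unzipAll zipAll unzipAll-zipAll zipAll-unzipAll

replicate-++-∷ : ∀ {A : Set} k (x : A) xs → replicate k x ++ x ∷ xs ≡ x ∷ replicate k x ++ xs
replicate-++-∷ zero    x xs = refl
replicate-++-∷ (suc k) x xs = cong (x ∷_) (replicate-++-∷ k x xs)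

IsSchroderPath : ℕ → List SStep → Set
IsSchroderPath k σ = IsSchroderFrom 0 σ × sWidth σ ≡ 2 * k

semilength : List SStep → ℕ
semilength []       = 0
semilength (sU ∷ σ) = suc (semilength σ)
semilength (sD ∷ σ) = semilength σ
semilength (sF ∷ σ) = suc (semilength σ)

sWidth-semilength : ∀ {h σ} → IsSchroderFrom h σ → sWidth σ ≡ h + 2 * semilength σ
sWidth-semilength send = refl
sWidth-semilength {h} {sU ∷ σ} (sup p) =
  trans (cong suc (sWidth-semilength p)) (arithmetic h (semilength σ))
  where
  arithmetic : ∀ h n → suc (suc h + 2 * n) ≡ h + 2 * suc n
  arithmetic = solve-∀
sWidth-semilength (sdown p) = cong suc (sWidth-semilength p)
sWidth-semilength {h} {sF ∷ σ} (sflat p) =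
  trans (cong (2 +_) (sWidth-semilength p)) (arithmetic h (semilength σ))
  where
  arithmetic : ∀ h n → 2 + (h + 2 * n) ≡ h + 2 * suc n
  arithmetic = solve-∀

isSchroderPath : ∀ {σ} → IsSchroderFrom 0 σ → IsSchroderPath (semilength σ) σ
isSchroderPath p = p , sWidth-semilength p

semilength-isSchroderPath : ∀ {k σ} → IsSchroderPath k σ → semilength σ ≡ k
semilength-isSchroderPath {k} {σ} (p , width) =
  *-cancelˡ-≡ (semilength σ) k 2 (trans (sym (sWidth-semilength p)) width)

isSchroderPath-irrelevant : ∀ {k σ} → Irrelevant (IsSchroderPath k σ)
isSchroderPath-irrelevant = ×-irrelevant isSchroderFrom-irrelevant ≡-irrelevant

data Letter : Set where
  sch   : SStep → Letter
  dyckD : Letter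

-- A marked word is a T-path each of whose steps records where it comes from:
-- a step of a Schröder path (H, G, D for sU, sF, sD) or a down-step of the
-- Dyck path.
data IsMarkedFrom : ℕ → ℕ → List Letter → Set where
  end      : IsMarkedFrom 0 0 []
  up       : ∀ {h s c} → IsMarkedFrom (suc h) (suc s) c → IsMarkedFrom h s (sch sU ∷ c)
  flat     : ∀ {h s c} → IsMarkedFrom (suc h) s c → IsMarkedFrom h s (sch sF ∷ c)
  down     : ∀ {h s c} → IsMarkedFrom h s c → IsMarkedFrom h (suc s) (sch sD ∷ c)
  dyckDown : ∀ {h c} → IsMarkedFrom h 0 c → IsMarkedFrom (suc h) 0 (dyckD ∷ c)

isMarkedFrom-irrelevant : ∀ {h s c} → Irrelevant (IsMarkedFrom h s c)
isMarkedFrom-irrelevant end          end          = refl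
isMarkedFrom-irrelevant (up p)       (up q)       = cong up (isMarkedFrom-irrelevant p q)
isMarkedFrom-irrelevant (flat p)     (flat q)     = cong flat (isMarkedFrom-irrelevant p q)
isMarkedFrom-irrelevant (down p)     (down q)     = cong down (isMarkedFrom-irrelevant p q)
isMarkedFrom-irrelevant (dyckDown p) (dyckDown q) = cong dyckDown (isMarkedFrom-irrelevant p q)

dyck : List Letter → List DStep
dyck []           = []
dyck (sch sU ∷ c) = U ∷ dyck c
dyck (sch sF ∷ c) = U ∷ dyck c
dyck (sch sD ∷ c) = dyck c
dyck (dyckD ∷ c)  = D ∷ dyck c

isDyckFrom-dyck : ∀ {h s c} → IsMarkedFrom h s c → IsDyckFrom h (dyck c)
isDyckFrom-dyck end          = dend
isDyckFrom-dyck (up p)       = dup (isDyckFrom-dyck p)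
isDyckFrom-dyck (flat p)     = dup (isDyckFrom-dyck p)
isDyckFrom-dyck (down p)     = isDyckFrom-dyck p
isDyckFrom-dyck (dyckDown p) = ddown (isDyckFrom-dyck p)

dyck-map-sch-++ : ∀ σ c → dyck (map sch σ ++ c) ≡ replicate (semilength σ) U ++ dyck c
dyck-map-sch-++ []       c = refl
dyck-map-sch-++ (sU ∷ σ) c = cong (U ∷_) (dyck-map-sch-++ σ c)
dyck-map-sch-++ (sD ∷ σ) c = dyck-map-sch-++ σ c
dyck-map-sch-++ (sF ∷ σ) c = cong (U ∷_) (dyck-map-sch-++ σ c)

isMarkedFrom-map-sch-++ : ∀ {h s σ c} → IsSchroderFrom s σ →
                          IsMarkedFrom (semilength σ + h) 0 c → IsMarkedFrom h s (map sch σ ++ c)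
isMarkedFrom-map-sch-++ send q = q
isMarkedFrom-map-sch-++ {h} {σ = sU ∷ σ} {c} (sup p) q =
  up (isMarkedFrom-map-sch-++ p (subst (λ m → IsMarkedFrom m 0 c) (sym (+-suc (semilength σ) h)) q))
isMarkedFrom-map-sch-++ (sdown p) q = down (isMarkedFrom-map-sch-++ p q)
isMarkedFrom-map-sch-++ {h} {σ = sF ∷ σ} {c} (sflat p) q =
  flat (isMarkedFrom-map-sch-++ p (subst (λ m → IsMarkedFrom m 0 c) (sym (+-suc (semilength σ) h)) q))

erase : List Letter → List TStep
erase []           = []
erase (sch sU ∷ c) = tH ∷ erase c
erase (sch sF ∷ c) = tG ∷ erase c
erase (sch sD ∷ c) = tD ∷ erase c
erase (dyckD ∷ c)  = tD ∷ erase c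

-- The argument is the height of the current Schröder path.
mark : ℕ → List TStep → List Letter
mark s       []       = []
mark s       (tH ∷ t) = sch sU ∷ mark (suc s) t
mark s       (tG ∷ t) = sch sF ∷ mark s t
mark (suc s) (tD ∷ t) = sch sD ∷ mark s t
mark zero    (tD ∷ t) = dyckD ∷ mark zero t

erase-mark : ∀ s t → erase (mark s t) ≡ t
erase-mark s       []       = refl
erase-mark s       (tH ∷ t) = cong (tH ∷_) (erase-mark (suc s) t)
erase-mark s       (tG ∷ t) = cong (tG ∷_) (erase-mark s t)
erase-mark (suc s) (tD ∷ t) = cong (tD ∷_) (erase-mark s t)
erase-mark zero    (tD ∷ t) = cong (tD ∷_) (erase-mark zero t)

mark-erase : ∀ {h s c} → IsMarkedFrom h s c → mark s (erase c) ≡ c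
mark-erase end          = refl
mark-erase (up p)       = cong (sch sU ∷_) (mark-erase p)
mark-erase (flat p)     = cong (sch sF ∷_) (mark-erase p)
mark-erase (down p)     = cong (sch sD ∷_) (mark-erase p)
mark-erase (dyckDown p) = cong (dyckD ∷_) (mark-erase p)

isTFrom-erase : ∀ {h s c} → IsMarkedFrom h s c → IsTFrom (h + s) (erase c)
isTFrom-erase end = tend
isTFrom-erase {h} {s} {_ ∷ c} (up p) =
  tstepH (subst (λ m → IsTFrom m (erase c)) (cong suc (+-suc h s)) (isTFrom-erase p))
isTFrom-erase (flat p) = tstepG (isTFrom-erase p)
isTFrom-erase {h} {suc s} {_ ∷ c} (down p) =
  subst (λ m → IsTFrom m (tD ∷ erase c)) (sym (+-suc h s)) (tstepD (isTFrom-erase p))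
isTFrom-erase (dyckDown p) = tstepD (isTFrom-erase p)

isMarkedFrom-mark : ∀ {m} h s {t} → IsTFrom m t → m ≡ h + s → IsMarkedFrom h s (mark s t)
isMarkedFrom-mark zero    zero    tend       _  = end
isMarkedFrom-mark zero    (suc s) tend       ()
isMarkedFrom-mark (suc h) s       tend       ()
isMarkedFrom-mark h       s       (tstepH p) eq =
  up (isMarkedFrom-mark (suc h) (suc s) p (cong suc (trans (cong suc eq) (sym (+-suc h s)))))
isMarkedFrom-mark h       s       (tstepG p) eq = flat (isMarkedFrom-mark (suc h) s p (cong suc eq))
isMarkedFrom-mark h       (suc s) (tstepD p) eq =
  down (isMarkedFrom-mark h s p (suc-injective (trans eq (+-suc h s))))
isMarkedFrom-mark zero    zero    (tstepD p) ()
isMarkedFrom-mark (suc h) zero    (tstepD p) eq = dyckDown (isMarkedFrom-mark h zero p (suc-injective eq))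

shifted-≡ : ∀ k {a b a′ b′ : ℕ} → a ≡ k + a′ → b ≡ k + b′ → a′ ≡ b′ → a ≡ b
shifted-≡ k a≡ b≡ refl = trans a≡ (sym b≡)

width-invariant : ∀ {h s c} → IsMarkedFrom h s c →
                  2 * tWidth (erase c) + h ≡ 3 * length (dyck c) + 2 * s
width-invariant end = refl
width-invariant {h} {s} {_ ∷ c} (up p) =
  shifted-≡ 1 (lhs (tWidth (erase c)) h) (rhs (length (dyck c)) s) (width-invariant p)
  where
  lhs : ∀ W h → 2 * suc W + h ≡ 1 + (2 * W + suc h)
  lhs = solve-∀
  rhs : ∀ L s → 3 * suc L + 2 * s ≡ 1 + (3 * L + 2 * suc s)
  rhs = solve-∀
width-invariant {h} {s} {_ ∷ c} (flat p) =
  shifted-≡ 3 (lhs (tWidth (erase c)) h) (rhs (length (dyck c)) s) (width-invariant p)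
  where
  lhs : ∀ W h → 2 * (2 + W) + h ≡ 3 + (2 * W + suc h)
  lhs = solve-∀
  rhs : ∀ L s → 3 * suc L + 2 * s ≡ 3 + (3 * L + 2 * s)
  rhs = solve-∀
width-invariant {h} {suc s} {_ ∷ c} (down p) =
  shifted-≡ 2 (lhs (tWidth (erase c)) h) (rhs (length (dyck c)) s) (width-invariant p)
  where
  lhs : ∀ W h → 2 * suc W + h ≡ 2 + (2 * W + h)
  lhs = solve-∀
  rhs : ∀ L s → 3 * L + 2 * suc s ≡ 2 + (3 * L + 2 * s)
  rhs = solve-∀
width-invariant {suc h} {_} {_ ∷ c} (dyckDown p) =
  shifted-≡ 3 (lhs (tWidth (erase c)) h) (rhs (length (dyck c))) (width-invariant p)
  where
  lhs : ∀ W h → 2 * suc W + suc h ≡ 3 + (2 * W + h)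
  lhs = solve-∀
  rhs : ∀ L → 3 * suc L + 2 * 0 ≡ 3 + (3 * L + 2 * 0)
  rhs = solve-∀

MarkedWord : ℕ → Set
MarkedWord n = Σ (List Letter) λ c → IsMarkedFrom 0 0 c × length (dyck c) ≡ 2 * n

length⇒tWidth : ∀ n {c} → IsMarkedFrom 0 0 c → length (dyck c) ≡ 2 * n → tWidth (erase c) ≡ 3 * n
length⇒tWidth n {c} p eq = *-cancelˡ-≡ (tWidth (erase c)) (3 * n) 2 (begin
  2 * tWidth (erase c)     ≡⟨ sym (+-identityʳ _) ⟩
  2 * tWidth (erase c) + 0 ≡⟨ width-invariant p ⟩
  3 * length (dyck c) + 0  ≡⟨ +-identityʳ _ ⟩
  3 * length (dyck c)      ≡⟨ cong (3 *_) eq ⟩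
  3 * (2 * n)              ≡⟨ commute n ⟩
  2 * (3 * n)              ∎)
  where
  open ≡-Reasoning
  commute : ∀ n → 3 * (2 * n) ≡ 2 * (3 * n)
  commute = solve-∀

tWidth⇒length : ∀ n {c} → IsMarkedFrom 0 0 c → tWidth (erase c) ≡ 3 * n → length (dyck c) ≡ 2 * n
tWidth⇒length n {c} p eq = *-cancelˡ-≡ (length (dyck c)) (2 * n) 3 (begin
  3 * length (dyck c)      ≡⟨ sym (+-identityʳ _) ⟩
  3 * length (dyck c) + 0  ≡⟨ sym (width-invariant p) ⟩
  2 * tWidth (erase c) + 0 ≡⟨ +-identityʳ _ ⟩
  2 * tWidth (erase c)     ≡⟨ cong (2 *_) eq ⟩
  2 * (3 * n)              ≡⟨ commute n ⟩
  3 * (2 * n)              ∎)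
  where
  open ≡-Reasoning
  commute : ∀ n → 2 * (3 * n) ≡ 3 * (2 * n)
  commute = solve-∀

MarkedWord↔TPath : ∀ n → MarkedWord n ↔ TPath n
MarkedWord↔TPath n = mk↔ₛ′ toT fromT toT-fromT fromT-toT
  where
  toT : MarkedWord n → TPath n
  toT (c , p , eq) = erase c , isTFrom-erase p , length⇒tWidth n p eq

  fromT : TPath n → MarkedWord n
  fromT (t , q , eq) = mark 0 t , p , tWidth⇒length n p (trans (cong tWidth (erase-mark 0 t)) eq)
    where
    p : IsMarkedFrom 0 0 (mark 0 t)
    p = isMarkedFrom-mark 0 0 q refl

  toT-fromT : ∀ t → toT (fromT t) ≡ t
  toT-fromT (t , _) = Σ-≡-irrelevant (×-irrelevant isTFrom-irrelevant ≡-irrelevant) (erase-mark 0 t)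

  fromT-toT : ∀ c → fromT (toT c) ≡ c
  fromT-toT (c , p , _) = Σ-≡-irrelevant (×-irrelevant isMarkedFrom-irrelevant ≡-irrelevant) (mark-erase p)

-- The ascent of length k, whose U-steps have just been read, is replaced by
-- its decoration σ once it ends; a missing decoration gives junk [].
flatten : ℕ → List DStep → List (List SStep) → List Letter
flatten k       (U ∷ w) ss       = flatten (suc k) w ss
flatten zero    []      _        = []
flatten zero    (D ∷ w) ss       = dyckD ∷ flatten zero w ss
flatten (suc k) w       []       = []
flatten (suc k) w       (σ ∷ ss) = map sch σ ++ flatten zero w ss

block : List Letter → List SStep
block []          = []
block (sch x ∷ c) = x ∷ block c
block (dyckD ∷ c) = []

afterBlock : List Letter → List Letter
afterBlock []          = []
afterBlock (sch _ ∷ c) = afterBlock c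
afterBlock (dyckD ∷ c) = dyckD ∷ c

consIfNonEmpty : ∀ {A : Set} → List A → List (List A) → List (List A)
consIfNonEmpty []       xss = xss
consIfNonEmpty (x ∷ xs) xss = (x ∷ xs) ∷ xss

blocks laterBlocks : List Letter → List (List SStep)
blocks c = consIfNonEmpty (block c) (laterBlocks c)

laterBlocks []          = []
laterBlocks (sch _ ∷ c) = laterBlocks c
laterBlocks (dyckD ∷ c) = blocks c

map-sch-block-++-afterBlock : ∀ c → map sch (block c) ++ afterBlock c ≡ c
map-sch-block-++-afterBlock []          = refl
map-sch-block-++-afterBlock (sch x ∷ c) = cong (sch x ∷_) (map-sch-block-++-afterBlock c)
map-sch-block-++-afterBlock (dyckD ∷ c) = refl

block-map-sch-++ : ∀ σ {c} → block c ≡ [] → block (map sch σ ++ c) ≡ σ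
block-map-sch-++ []      eq = eq
block-map-sch-++ (x ∷ σ) eq = cong (x ∷_) (block-map-sch-++ σ eq)

laterBlocks-map-sch-++ : ∀ σ c → laterBlocks (map sch σ ++ c) ≡ laterBlocks c
laterBlocks-map-sch-++ []      c = refl
laterBlocks-map-sch-++ (x ∷ σ) c = laterBlocks-map-sch-++ σ c

blocks-map-sch-∷-++ : ∀ x σ {c} → block c ≡ [] → blocks (map sch (x ∷ σ) ++ c) ≡ (x ∷ σ) ∷ laterBlocks c
blocks-map-sch-∷-++ x σ {c} eq =
  cong₂ (λ b bs → (x ∷ b) ∷ bs) (block-map-sch-++ σ eq) (laterBlocks-map-sch-++ σ c)

block-isSchroderFrom : ∀ {h s c} → IsMarkedFrom h s c → IsSchroderFrom s (block c)
block-isSchroderFrom end          = send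
block-isSchroderFrom (up p)       = sup (block-isSchroderFrom p)
block-isSchroderFrom (flat p)     = sflat (block-isSchroderFrom p)
block-isSchroderFrom (down p)     = sdown (block-isSchroderFrom p)
block-isSchroderFrom (dyckDown p) = send

dyck-map-sch-++-ascent : ∀ {k σ c w} → IsSchroderPath k σ → dyck c ≡ w →
                         dyck (map sch σ ++ c) ≡ replicate k U ++ w
dyck-map-sch-++-ascent {σ = σ} {c} p eq =
  trans (dyck-map-sch-++ σ c) (cong₂ (λ m w → replicate m U ++ w) (semilength-isSchroderPath p) eq)

dyck-flatten : ∀ k w {ss} → Pointwise IsSchroderPath (ascentsFrom k w) ss →
               dyck (flatten k w ss) ≡ replicate k U ++ w
dyck-flatten zero    []      [] = refl
dyck-flatten zero    (U ∷ w) ps = dyck-flatten 1 w ps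
dyck-flatten (suc k) (U ∷ w) ps = trans (dyck-flatten (suc (suc k)) w ps) (sym (replicate-++-∷ (suc k) U w))
dyck-flatten zero    (D ∷ w) ps = cong (D ∷_) (dyck-flatten zero w ps)
dyck-flatten (suc k) []      (p ∷ ps) = dyck-map-sch-++-ascent {suc k} p (dyck-flatten zero [] ps)
dyck-flatten (suc k) (D ∷ w) (p ∷ ps) = dyck-map-sch-++-ascent {suc k} p (dyck-flatten zero (D ∷ w) ps)

blocks-flatten : ∀ k w {ss} → Pointwise IsSchroderPath (ascentsFrom k w) ss → blocks (flatten k w ss) ≡ ss
blocks-flatten zero    []      [] = refl
blocks-flatten zero    (U ∷ w) ps = blocks-flatten 1 w ps
blocks-flatten (suc k) (U ∷ w) ps = blocks-flatten (suc (suc k)) w ps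
blocks-flatten zero    (D ∷ w) ps = blocks-flatten zero w ps
blocks-flatten (suc k) []      ((send , ()) ∷ _)
blocks-flatten (suc k) []      {(x ∷ σ) ∷ _} (_ ∷ []) = blocks-map-sch-∷-++ x σ refl
blocks-flatten (suc k) (D ∷ w) ((send , ()) ∷ _)
blocks-flatten (suc k) (D ∷ w) {(x ∷ σ) ∷ _} (_ ∷ ps) =
  trans (blocks-map-sch-∷-++ x σ refl) (cong ((x ∷ σ) ∷_) (blocks-flatten zero w ps))

isMarkedFrom-flatten : ∀ k w {h ss} → IsDyckFrom (k + h) w → Pointwise IsSchroderPath (ascentsFrom k w) ss →
                       IsMarkedFrom h 0 (flatten k w ss)
isMarkedFrom-flatten zero    []      dend      [] = end
isMarkedFrom-flatten zero    (U ∷ w) (dup d)   ps = isMarkedFrom-flatten 1 w d ps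
isMarkedFrom-flatten (suc k) (U ∷ w) (dup d)   ps = isMarkedFrom-flatten (suc (suc k)) w d ps
isMarkedFrom-flatten zero    (D ∷ w) (ddown d) ps = dyckDown (isMarkedFrom-flatten zero w d ps)
isMarkedFrom-flatten (suc k) (D ∷ w) {h} {σ ∷ ss} (ddown d) (p ∷ ps) =
  isMarkedFrom-map-sch-++ (proj₁ p)
    (subst (λ m → IsMarkedFrom (m + h) 0 (dyckD ∷ flatten zero w ss)) (sym (semilength-isSchroderPath p))
           (dyckDown (isMarkedFrom-flatten zero w d ps)))

-- Inside an ascent, flatten copies the head decoration without inspecting it,
-- so the decoration τ of the current ascent may be arbitrary.
flatten-blocks : ∀ {h c} → IsMarkedFrom h 0 c → flatten 0 (dyck c) (blocks c) ≡ c
flatten-laterBlocks : ∀ {h s c} → IsMarkedFrom h s c → ∀ k τ →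
                      flatten (suc k) (dyck c) (τ ∷ laterBlocks c) ≡ map sch τ ++ afterBlock c

flatten-blocks end = refl
flatten-blocks {c = _ ∷ c} (up p) =
  trans (flatten-laterBlocks p 0 (sU ∷ block c)) (cong (sch sU ∷_) (map-sch-block-++-afterBlock c))
flatten-blocks {c = _ ∷ c} (flat p) =
  trans (flatten-laterBlocks p 0 (sF ∷ block c)) (cong (sch sF ∷_) (map-sch-block-++-afterBlock c))
flatten-blocks (dyckDown p) = cong (dyckD ∷_) (flatten-blocks p)

flatten-laterBlocks end          k τ = refl
flatten-laterBlocks (up p)       k τ = flatten-laterBlocks p (suc k) τ
flatten-laterBlocks (flat p)     k τ = flatten-laterBlocks p (suc k) τ
flatten-laterBlocks (down p)     k τ = flatten-laterBlocks p k τ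
flatten-laterBlocks (dyckDown p) k τ = cong (λ c → map sch τ ++ dyckD ∷ c) (flatten-blocks p)

pointwise-blocks : ∀ {h c} → IsMarkedFrom h 0 c → Pointwise IsSchroderPath (ascents (dyck c)) (blocks c)
pointwise-laterBlocks : ∀ {h s c} → IsMarkedFrom h s c → ∀ k {τ} →
                        IsSchroderPath (suc k + semilength (block c)) τ →
                        Pointwise IsSchroderPath (ascentsFrom (suc k) (dyck c)) (τ ∷ laterBlocks c)

pointwise-blocks end = []
pointwise-blocks (up p) = pointwise-laterBlocks p 0 (isSchroderPath (block-isSchroderFrom (up p)))
pointwise-blocks (flat p) = pointwise-laterBlocks p 0 (isSchroderPath (block-isSchroderFrom (flat p)))
pointwise-blocks (dyckDown p) = pointwise-blocks p

pointwise-laterBlocks end k {τ} q = subst (λ m → IsSchroderPath m τ) (+-identityʳ (suc k)) q ∷ []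
pointwise-laterBlocks {c = _ ∷ c} (up p) k {τ} q =
  pointwise-laterBlocks p (suc k) (subst (λ m → IsSchroderPath m τ) (+-suc (suc k) (semilength (block c))) q)
pointwise-laterBlocks {c = _ ∷ c} (flat p) k {τ} q =
  pointwise-laterBlocks p (suc k) (subst (λ m → IsSchroderPath m τ) (+-suc (suc k) (semilength (block c))) q)
pointwise-laterBlocks (down p) k q = pointwise-laterBlocks p k q
pointwise-laterBlocks (dyckDown p) k {τ} q =
  subst (λ m → IsSchroderPath m τ) (+-identityʳ (suc k)) q ∷ pointwise-blocks p

DecoratedDyck : ℕ → Set
DecoratedDyck n = Σ (DyckPath n) λ P → Σ (List (List SStep)) (Pointwise IsSchroderPath (ascents (proj₁ P)))

DS↔DecoratedDyck : ∀ n → DS n ↔ DecoratedDyck n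
DS↔DecoratedDyck n = Σ-↔ (↔-id (DyckPath n)) All↔Pointwise

decoratedDyck-≡ : ∀ {n w w′ d d′ ss ss′ ps ps′} → w ≡ w′ → ss ≡ ss′ →
                  _≡_ {A = DecoratedDyck n} ((w , d) , ss , ps) ((w′ , d′) , ss′ , ps′)
decoratedDyck-≡ {d = d} {d′} {ps = ps} {ps′} refl refl =
  cong₂ (λ d ps → ((_ , d) , _ , ps))
        (×-irrelevant isDyckFrom-irrelevant ≡-irrelevant d d′)
        (Pointwise.irrelevant (λ {k} → isSchroderPath-irrelevant {k}) ps ps′)

DecoratedDyck↔MarkedWord : ∀ n → DecoratedDyck n ↔ MarkedWord n
DecoratedDyck↔MarkedWord n = mk↔ₛ′ toMarked fromMarked toMarked-fromMarked fromMarked-toMarked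
  where
  toMarked : DecoratedDyck n → MarkedWord n
  toMarked ((w , d , len) , ss , ps) =
    flatten 0 w ss , isMarkedFrom-flatten 0 w d ps , trans (cong length (dyck-flatten 0 w ps)) len

  fromMarked : MarkedWord n → DecoratedDyck n
  fromMarked (c , p , len) = (dyck c , isDyckFrom-dyck p , len) , blocks c , pointwise-blocks p

  toMarked-fromMarked : ∀ c → toMarked (fromMarked c) ≡ c
  toMarked-fromMarked (_ , p , _) =
    Σ-≡-irrelevant (×-irrelevant isMarkedFrom-irrelevant ≡-irrelevant) (flatten-blocks p)

  fromMarked-toMarked : ∀ x → fromMarked (toMarked x) ≡ x
  fromMarked-toMarked ((w , _) , _ , ps) = decoratedDyck-≡ {n} (dyck-flatten 0 w ps) (blocks-flatten 0 w ps)

mainTheorem5 : (n : ℕ) → DS n ⤖ TPath n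
mainTheorem5 n = ↔⇒⤖ (MarkedWord↔TPath n ↔-∘ (DecoratedDyck↔MarkedWord n ↔-∘ DS↔DecoratedDyck n))
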